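{- Let $\mathbf t:\mathcal D\to\mathcal T$ be a functor, $c:A\to B$ a morphism of $\mathcal T$ and $P\sqsubset A$. Whenever the pushforward $c_!P$ exists in $\mathbf t$, there is a natural isomorphism $(c_!P)^-\cong(c^-)^*P^-=P^-\circ(c^-)^{op}$ of presheaves on $B^-$.
   Context: Write $P\sqsubset A$ if $\mathbf t(P)=A$; composition is diagrammatic ($c;d$ = $c$ then $d$); a derivation $\alpha:P\Rightarrow_c Q$ is a morphism of $\mathcal D$ with $\mathbf t(\alpha)=c$. A pushforward of $P\sqsubset A$ along $c:A\to B$ is $c_!P\sqsubset B$ with a derivation $r:P\Rightarrow_c c_!P$ such that for all $Q\sqsubset C$, $d:B\to C$, $\beta\mapsto r;\beta$ is a bijection from derivations $c_!P\Rightarrow_d Q$ to derivations $P\Rightarrow_{c;d}Q$. For a type $A$, the relative coslice of $A$ has objects $(d,R)$ with $d:A\to C$, $R\sqsubset C$, and morphisms $(d_1,R_1)\to(d_2,R_2)$ the derivations $\gamma:R_1\Rightarrow_e R_2$ with $d_1;e=d_2$; $A^-$ denotes its opposite category. For $c:A\to B$, $c^-:B^-\to A^-$ is induced by $(d,R)\mapsto(c;d,R)$, $\gamma\mapsto\gamma$. For $P\sqsubset A$, the presheaf $P^-:(A^-)^{op}\to\mathbf{Set}$ (a covariant functor on the coslice) sends $(d,R)$ to the set of derivations $P\Rightarrow_d R$, coslice morphisms acting by postcomposition. -}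

module Defs where

open import Level using (Level; _⊔_) renaming (suc to lsuc)
open import Data.Product using (Σ; _,_; proj₁; proj₂)
open import Relation.Binary.PropositionalEquality
  using (_≡_; refl; sym; trans; cong; cong₂)
open import Function.Definitions using (Bijective)
open import Function.Bundles using (_↔_; Inverse)

record Category (o ℓ : Level) : Set (lsuc (o ⊔ ℓ)) where
  infixr 9 _⨾_
  field
    Obj : Set o
    Hom : Obj → Obj → Set ℓ
    id  : ∀ {A} → Hom A A
    _⨾_ : ∀ {A B C} → Hom A B → Hom B C → Hom A C
    identityˡ : ∀ {A B} (f : Hom A B) → id ⨾ f ≡ f
    identityʳ : ∀ {A B} (f : Hom A B) → f ⨾ id ≡ f
    assoc : ∀ {A B C D} (f : Hom A B) (g : Hom B C) (h : Hom C D) →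
            (f ⨾ g) ⨾ h ≡ f ⨾ (g ⨾ h)
    Hom-isSet : ∀ {A B} {f g : Hom A B} (p q : f ≡ g) → p ≡ q

record Functor {o₁ ℓ₁ o₂ ℓ₂ : Level} (𝒟 : Category o₁ ℓ₁) (𝒯 : Category o₂ ℓ₂)
       : Set (o₁ ⊔ ℓ₁ ⊔ o₂ ⊔ ℓ₂) where
  private
    module D = Category 𝒟
    module T = Category 𝒯
  field
    F₀ : D.Obj → T.Obj
    F₁ : ∀ {X Y} → D.Hom X Y → T.Hom (F₀ X) (F₀ Y)
    F-id : ∀ {X} → F₁ (D.id {X}) ≡ T.id
    F-hom : ∀ {X Y Z} (f : D.Hom X Y) (g : D.Hom Y Z) →
            F₁ (f D.⨾ g) ≡ F₁ f T.⨾ F₁ g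

transp : ∀ {o ℓ} (𝒞 : Category o ℓ) {A A' B B' : Category.Obj 𝒞} →
         A ≡ A' → B ≡ B' → Category.Hom 𝒞 A B → Category.Hom 𝒞 A' B'
transp 𝒞 refl refl f = f

transp-⨾ : ∀ {o ℓ} (𝒞 : Category o ℓ) {A A' B B' C C' : Category.Obj 𝒞}
           (p : A ≡ A') (q : B ≡ B') (r : C ≡ C')
           (f : Category.Hom 𝒞 A B) (g : Category.Hom 𝒞 B C) →
           Category._⨾_ 𝒞 (transp 𝒞 p q f) (transp 𝒞 q r g)
             ≡ transp 𝒞 p r (Category._⨾_ 𝒞 f g)
transp-⨾ 𝒞 refl refl refl f g = refl

module Over {o₁ ℓ₁ o₂ ℓ₂ : Level} {𝒟 : Category o₁ ℓ₁} {𝒯 : Category o₂ ℓ₂}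
            (t : Functor 𝒟 𝒯) where
  private
    module D = Category 𝒟
    module T = Category 𝒯
  open Functor t

  _⊏_ : D.Obj → T.Obj → Set o₂
  P ⊏ A = F₀ P ≡ A

  Deriv : ∀ {P Q A B} → P ⊏ A → Q ⊏ B → T.Hom A B → Set (ℓ₁ ⊔ ℓ₂)
  Deriv {P} {Q} p q c = Σ (D.Hom P Q) (λ α → transp 𝒯 p q (F₁ α) ≡ c)

  _⊙_ : ∀ {P Q R A B C} {p : P ⊏ A} {q : Q ⊏ B} {r : R ⊏ C}
          {c : T.Hom A B} {d : T.Hom B C} →
        Deriv p q c → Deriv q r d → Deriv p r (c T.⨾ d)
  _⊙_ {p = p} {q} {r} (α , eα) (β , eβ) =
    α D.⨾ β ,
    trans (cong (transp 𝒯 p r) (F-hom α β))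
      (trans (sym (transp-⨾ 𝒯 p q r (F₁ α) (F₁ β))) (cong₂ T._⨾_ eα eβ))

  record Pushforward {P A B} (p : P ⊏ A) (c : T.Hom A B)
         : Set (o₁ ⊔ ℓ₁ ⊔ o₂ ⊔ ℓ₂) where
    field
      c!P : D.Obj
      c!P⊏B : c!P ⊏ B
      unit : Deriv p c!P⊏B c
      universal : ∀ {Q C} (q : Q ⊏ C) (d : T.Hom B C) →
                  Bijective _≡_ _≡_ (λ (β : Deriv c!P⊏B q d) → unit ⊙ β)

  record CObj (A : T.Obj) : Set (o₁ ⊔ o₂ ⊔ ℓ₂) where
    constructor cobj
    field
      {C} : T.Obj
      d : T.Hom A C
      R : D.Obj
      R⊏C : R ⊏ C
  open CObj

  record CHom {A : T.Obj} (X Y : CObj A) : Set (ℓ₁ ⊔ ℓ₂) where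
    constructor chom
    field
      e : T.Hom (C X) (C Y)
      γ : Deriv (R⊏C X) (R⊏C Y) e
      comm : d X T.⨾ e ≡ d Y

  -- c⁻ : B⁻ → A⁻, presented covariantly on coslices
  c⁻₀ : ∀ {A B} → T.Hom A B → CObj B → CObj A
  c⁻₀ c (cobj d R r) = cobj (c T.⨾ d) R r

  c⁻₁ : ∀ {A B} (c : T.Hom A B) {X Y : CObj B} → CHom X Y → CHom (c⁻₀ c X) (c⁻₀ c Y)
  c⁻₁ c {X} {Y} (chom e γ comm) =
    chom e γ (trans (T.assoc c (d X) e) (cong (c T.⨾_) comm))

  -- presheaves on A⁻ = covariant Set-valued functors on the coslice of A
  -- (only the data used by the statement is recorded)
  record Presheaf (A : T.Obj) : Set (lsuc (o₁ ⊔ ℓ₁ ⊔ o₂ ⊔ ℓ₂)) where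
    field
      ob : CObj A → Set (ℓ₁ ⊔ ℓ₂)
      act : ∀ {X Y} → CHom X Y → ob X → ob Y

  postcomp : ∀ {P A} (p : P ⊏ A) {X Y : CObj A} → CHom X Y →
             Deriv p (R⊏C X) (d X) → Deriv p (R⊏C Y) (d Y)
  postcomp p (chom e γ comm) α with α ⊙ γ
  ... | (δ , eδ) = δ , trans eδ comm

  _⁻ : ∀ {P A} → P ⊏ A → Presheaf A
  p ⁻ = record { ob = λ X → Deriv p (R⊏C X) (d X) ; act = postcomp p }

  restrict : ∀ {A B} (c : T.Hom A B) → Presheaf A → Presheaf B
  restrict c F = record
    { ob = λ X → Presheaf.ob F (c⁻₀ c X)
    ; act = λ γ → Presheaf.act F (c⁻₁ c γ) }

  record NatIso {A : T.Obj} (F G : Presheaf A) : Set (o₁ ⊔ ℓ₁ ⊔ o₂ ⊔ ℓ₂) where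
    field
      η : ∀ X → Presheaf.ob F X ↔ Presheaf.ob G X
      natural : ∀ {X Y} (γ : CHom X Y) (x : Presheaf.ob F X) →
                Inverse.to (η Y) (Presheaf.act F γ x)
                  ≡ Presheaf.act G γ (Inverse.to (η X) x)

module Submission where

open import Defs
open import Level using (Level)
open import Data.Product using (_,_; proj₁)
open import Data.Product.Properties using (Σ-≡,≡→≡)
open import Relation.Binary.PropositionalEquality using (_≡_; sym)
open import Function.Bundles using (_↔_; mk⤖)
open import Function.Properties.Bijection using (⤖⇒↔)

module _ {o₁ ℓ₁ o₂ ℓ₂ : Level} {𝒟 : Category o₁ ℓ₁} {𝒯 : Category o₂ ℓ₂}
         (t : Functor 𝒟 𝒯) where
  private
    module D = Category 𝒟
    module T = Category 𝒯
  open Over t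
  open CObj

  -- The typing condition t(α) = c is a proposition, as hom-sets of 𝒯 are sets.
  Deriv-≡ : ∀ {P Q A B} {p : P ⊏ A} {q : Q ⊏ B} {c : T.Hom A B} {α β : Deriv p q c} →
            proj₁ α ≡ proj₁ β → α ≡ β
  Deriv-≡ eq = Σ-≡,≡→≡ (eq , T.Hom-isSet _ _)

  ⊙-postcomp : ∀ {P Q A B} {p : P ⊏ A} {q : Q ⊏ B} {c : T.Hom A B} {X Y : CObj B}
               (α : Deriv p q c) (γ : CHom X Y) (β : Deriv q (R⊏C X) (d X)) →
               α ⊙ postcomp q γ β ≡ postcomp p (c⁻₁ c γ) (α ⊙ β)
  ⊙-postcomp (α , _) (chom e (γ , _) comm) (β , _) = Deriv-≡ (sym (D.assoc α β γ))

  pushforward-↔ : ∀ {P A B} {p : P ⊏ A} {c : T.Hom A B} (pf : Pushforward p c) (X : CObj B) →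
                  Deriv (Pushforward.c!P⊏B pf) (R⊏C X) (d X) ↔ Deriv p (R⊏C X) (c T.⨾ d X)
  pushforward-↔ pf (cobj d R r) = ⤖⇒↔ (mk⤖ (Pushforward.universal pf r d))

proposition3p19 : ∀ {o₁ ℓ₁ o₂ ℓ₂ : Level} {𝒟 : Category o₁ ℓ₁} {𝒯 : Category o₂ ℓ₂}
    (t : Functor 𝒟 𝒯) {A B : Category.Obj 𝒯} (c : Category.Hom 𝒯 A B)
    (P : Category.Obj 𝒟) (p : Over._⊏_ t P A) (pf : Over.Pushforward t p c) →
    Over.NatIso t (Over._⁻ t (Over.Pushforward.c!P⊏B pf)) (Over.restrict t c (Over._⁻ t p))
proposition3p19 t c P p pf = record
  { η = pushforward-↔ t pf
  ; natural = ⊙-postcomp t (Pushforward.unit pf) }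
  where open Over t
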